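{- Let $n=p_1^{a_1}p_2^{a_2}\cdots p_k^{a_k}$, where the $p_i$ are distinct primes and each $a_i$ is a positive integer, and let $Q$ be the poset of join-irreducible elements of the divisibility lattice $L_n$ (i.e., the prime powers $p_i^{b}$, $1\le b\le a_i$, ordered by divisibility; $Q$ is a disjoint sum of chains). Partition $Q$ as $Q_1+Q_2+\cdots+Q_j$, where $Q_i$ consists of $t_i$ chains, each consisting of $r_i$ points, and $r_1,\dots,r_j$ are distinct. For $1\le i\le j$, let $m_i$ be the smallest nonnegative integer such that $t_i\le \sum_{\ell=0}^{\min\{r_i,m_i\}}\binom{r_i}{\ell}(m_i)_\ell$, and let $m=\max\{m_i:1\le i\le j\}$. Then $\chi_D(L_n)\le m+|Q|+1$.
   Context: $L_n$ is the poset of positive divisors of $n$ ordered by divisibility. $(m)_\ell=m(m-1)\cdots(m-\ell+1)$ with $(m)_0=1$. For a finite poset $P$, a coloring is proper if comparable points get different colors and distinguishing if the only color-preserving automorphism is the identity; $\chi_D(P)$ is the least number of colors in a proper distinguishing coloring of $P$. -}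

module Defs where

open import Data.Nat using (ℕ; zero; suc; _+_; _*_; _∸_; _⊓_; _⊔_; _≤_)
open import Data.Nat.Divisibility using (_∣_; _∣?_)
open import Data.Nat.Combinatorics using (_C_)
open import Data.Fin using (Fin)
open import Data.List using (List; length; filter; allFin; map; foldr)
open import Data.Nat.ListAction using (sum; product)
open import Data.Product using (Σ; proj₁; _×_)
open import Relation.Nullary using (¬_)
open import Relation.Nullary.Decidable using (True)
open import Relation.Binary.PropositionalEquality using (_≡_; _≢_)
open import Function.Bundles using (_↔_; Inverse; _⇔_)

-- The poset L_n: positive divisors of n (for n ≥ 1), with a proof-irrelevant
-- membership witness so that propositional equality is equality of values.
Divisor : ℕ → Set
Divisor n = Σ ℕ (λ d → True (d ∣? n))

val : ∀ {n} → Divisor n → ℕ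
val = proj₁

record Automorphism (n : ℕ) : Set where
  field
    perm     : Divisor n ↔ Divisor n
    preserve : ∀ x y → (val x ∣ val y) ⇔ (val (Inverse.to perm x) ∣ val (Inverse.to perm y))

Proper : ∀ {n K} → (Divisor n → Fin K) → Set
Proper {n} c = ∀ (x y : Divisor n) → val x ∣ val y → x ≢ y → c x ≢ c y

Distinguishing : ∀ {n K} → (Divisor n → Fin K) → Set
Distinguishing {n} c = ∀ (σ : Automorphism n) →
  (∀ x → c (Inverse.to (Automorphism.perm σ) x) ≡ c x) →
  ∀ x → Inverse.to (Automorphism.perm σ) x ≡ x

-- χ_D(L_n) ≤ K  iff  L_n has a proper distinguishing coloring with at most K colors.
χD≤ : ℕ → ℕ → Set
χD≤ n K = Σ (Divisor n → Fin K) (λ c → Proper c × Distinguishing c)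

fall : ℕ → ℕ → ℕ
fall m zero    = 1
fall m (suc ℓ) = fall m ℓ * (m ∸ ℓ)

sumTo : ℕ → (ℕ → ℕ) → ℕ
sumTo zero    f = f 0
sumTo (suc u) f = sumTo u f + f (suc u)

Ok : ℕ → ℕ → ℕ → Set
Ok r t m = t ≤ sumTo (r ⊓ m) (λ ℓ → (r C ℓ) * fall m ℓ)

IsLeast : (ℕ → Set) → ℕ → Set
IsLeast P m = P m × (∀ m' → P m' → m ≤ m')

-- number of chains (indices j) whose length a j equals r
countEq : ∀ {k} → (Fin k → ℕ) → ℕ → ℕ
countEq {k} a r = length (filter (λ j → a j Data.Nat.≟ r) (allFin k))

maxF : ∀ {k} → (Fin k → ℕ) → ℕ
maxF {k} f = foldr _⊔_ 0 (map f (allFin k))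

sumF : ∀ {k} → (Fin k → ℕ) → ℕ
sumF {k} f = sum (map f (allFin k))

prodF : ∀ {k} → (Fin k → ℕ) → ℕ
prodF {k} f = product (map f (allFin k))

module Submission where

-- Each point x of L_n gets its rank Σ_i v_{p_i}(x) ∈ {0, …, N}, N = |Q|,
-- except on the chains  p_i, p_i², …, p_i^{a_i}  of join-irreducibles, where a
-- "pattern" is painted with M = max m_i extra colours N+1, …, N+M.  A pattern is a
-- partial injection from the positions {1 … r} of a chain into the colours; there are
-- Σ_ℓ C(r,ℓ) (m)_ℓ ≤ partials r m of them, so the t_i chains of length r_i can be
-- given pairwise distinct patterns with m_i colours (hypothesis IsLeast (Ok …)).
-- Properness: ranks increase strictly along divisibility, and a pattern never repeats
-- a colour on its chain.  Distinguishing: an automorphism fixes 1, preserves covers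
-- and the property "the down-set is a chain", hence maps each chain of prime powers
-- onto a chain of the same length; preserving colours it preserves the pattern, so
-- every chain is fixed pointwise, and then every divisor is fixed (valuations).

open import Defs
open import Data.Nat using (ℕ; _+_; _^_; _≤_)
open import Data.Nat.Primality using (Prime)
open import Data.Fin using (Fin)
open import Function.Definitions using (Injective)
open import Relation.Binary.PropositionalEquality using (_≡_)

open import Data.Nat using (zero; suc; _*_; _∸_; _⊓_; _⊔_; _<_; z≤n; s≤s; _≟_; _≤?_; _<?_; ≢-nonZero; ≢-nonZero⁻¹)
open import Data.Nat.Properties
open import Data.Nat.Divisibility
open import Data.Nat.Primality using (prime⇒nonZero; prime⇒irreducible; euclidsLemma; ¬prime[0]; ¬prime[1])
open import Data.Nat.Primality.Factorisation using (factorise)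
open import Data.Nat.Induction using (<-wellFounded)
open import Induction.WellFounded using (Acc; acc)
open import Data.List.Relation.Unary.All using (_∷_)
open import Data.Nat.Combinatorics using (_C_; nCk+nC[k+1]≡[n+1]C[k+1]; k>n⇒nCk≡0)
open import Data.Nat.ListAction using (sum; product)
open import Data.Nat.Tactic.RingSolver using (solve-∀)
import Data.Fin as Fin
open import Data.Fin using (toℕ; splitAt; remQuot; combine; join; punchIn)
import Data.Fin.Properties as Finₚ
open import Data.List using (List; []; _∷_; map; allFin; tabulate; foldr; filter; lookup)
open import Data.List.Membership.Propositional using (_∈_)
open import Data.List.Membership.Propositional.Properties using (∈-filter⁺; ∈-allFin)
open import Data.List.Relation.Unary.Any using (index)
open import Data.List.Relation.Unary.Any.Properties using (lookup-index)
open import Data.List.Properties using (map-tabulate)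
open import Data.Maybe using (Maybe; just; nothing)
import Data.Maybe as Maybe
open import Data.Maybe.Properties using (just-injective; map-injective)
open import Data.Sum using (_⊎_; inj₁; inj₂)
import Data.Sum as Sum
open import Data.Product using (_,_; proj₁; proj₂; _×_; ∃)
open import Data.Empty using (⊥-elim)
open import Relation.Binary.PropositionalEquality
  using (_≢_; refl; sym; trans; cong; cong₂; subst; subst₂; module ≡-Reasoning)
open import Relation.Nullary using (¬_; Dec; yes; no)
open import Relation.Nullary.Decidable using (toWitness; fromWitness; _×-dec_)
open import Data.Bool.Properties using (T-irrelevant)
open import Function using (_∘_)
open import Function.Bundles using (Inverse; Equivalence; mk⇔)
open import Function.Properties.Inverse using (↔-sym)

map-allFin-suc : ∀ {k} (f : Fin (suc k) → ℕ) → map f (allFin (suc k)) ≡ f Fin.zero ∷ map (f ∘ Fin.suc) (allFin k)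
map-allFin-suc f = cong (f Fin.zero ∷_) (trans (map-tabulate Fin.suc f) (sym (map-tabulate (λ i → i) (f ∘ Fin.suc))))

prodF-suc : ∀ {k} (f : Fin (suc k) → ℕ) → prodF f ≡ f Fin.zero * prodF (f ∘ Fin.suc)
prodF-suc f = cong product (map-allFin-suc f)

sumF-suc : ∀ {k} (f : Fin (suc k) → ℕ) → sumF f ≡ f Fin.zero + sumF (f ∘ Fin.suc)
sumF-suc f = cong sum (map-allFin-suc f)

maxF-suc : ∀ {k} (f : Fin (suc k) → ℕ) → maxF f ≡ f Fin.zero ⊔ maxF (f ∘ Fin.suc)
maxF-suc f = cong (foldr _⊔_ 0) (map-allFin-suc f)

sumF-mono : ∀ {k} (f g : Fin k → ℕ) → (∀ i → f i ≤ g i) → sumF f ≤ sumF g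
sumF-mono {zero}  f g f≤g = z≤n
sumF-mono {suc k} f g f≤g rewrite sumF-suc f | sumF-suc g =
  +-mono-≤ (f≤g Fin.zero) (sumF-mono (f ∘ Fin.suc) (g ∘ Fin.suc) (f≤g ∘ Fin.suc))

sumF-strict : ∀ {k} (f g : Fin k → ℕ) → (∀ i → f i ≤ g i) → ∀ j → f j < g j → sumF f < sumF g
sumF-strict {suc k} f g f≤g Fin.zero fj<gj rewrite sumF-suc f | sumF-suc g =
  +-mono-<-≤ fj<gj (sumF-mono (f ∘ Fin.suc) (g ∘ Fin.suc) (f≤g ∘ Fin.suc))
sumF-strict {suc k} f g f≤g (Fin.suc j) fj<gj rewrite sumF-suc f | sumF-suc g =
  +-mono-≤-< (f≤g Fin.zero) (sumF-strict (f ∘ Fin.suc) (g ∘ Fin.suc) (f≤g ∘ Fin.suc) j fj<gj)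

maxF-upper : ∀ {k} (f : Fin k → ℕ) i → f i ≤ maxF f
maxF-upper {suc k} f Fin.zero    rewrite maxF-suc f = m≤m⊔n (f Fin.zero) _
maxF-upper {suc k} f (Fin.suc i) rewrite maxF-suc f = ≤-trans (maxF-upper (f ∘ Fin.suc) i) (m≤n⊔m (f Fin.zero) _)

-- Counting partial injections.  `partials r m` is the number of partial injections
-- from an r-element set into an m-element set: position 1 is either left out, or
-- sent to one of the m values, the remaining r - 1 positions then avoiding it.
partials : ℕ → ℕ → ℕ
partials zero    m = 1
partials (suc r) m = partials r m + m * partials r (m ∸ 1)

partials-positive : ∀ r m → 1 ≤ partials r m
partials-positive zero    m = s≤s z≤n
partials-positive (suc r) m = ≤-trans (partials-positive r m) (m≤m+n _ _)

sumTo-shift : ∀ u g → sumTo (suc u) g ≡ g 0 + sumTo u (g ∘ suc)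
sumTo-shift zero    g = refl
sumTo-shift (suc u) g = trans (cong (_+ g (suc (suc u))) (sumTo-shift u g)) (+-assoc (g 0) _ _)

sumTo-cong : ∀ u {f g} → (∀ ℓ → f ℓ ≡ g ℓ) → sumTo u f ≡ sumTo u g
sumTo-cong zero    f≗g = f≗g 0
sumTo-cong (suc u) f≗g = cong₂ _+_ (sumTo-cong u f≗g) (f≗g (suc u))

sumTo-+ : ∀ u f g → sumTo u (λ ℓ → f ℓ + g ℓ) ≡ sumTo u f + sumTo u g
sumTo-+ zero    f g = refl
sumTo-+ (suc u) f g = trans (cong (_+ (f (suc u) + g (suc u))) (sumTo-+ u f g)) (interchange (sumTo u f) (sumTo u g) (f (suc u)) (g (suc u)))
  where
  interchange : ∀ w x y z → w + x + (y + z) ≡ w + y + (x + z)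
  interchange = solve-∀

sumTo-* : ∀ u c f → sumTo u (λ ℓ → c * f ℓ) ≡ c * sumTo u f
sumTo-* zero    c f = refl
sumTo-* (suc u) c f = trans (cong (_+ c * f (suc u)) (sumTo-* u c f)) (sym (*-distribˡ-+ c (sumTo u f) (f (suc u))))

-- (m)_(ℓ+1) = m (m-1)_ℓ, also for m = 0.
fall-suc : ∀ m ℓ → fall m (suc ℓ) ≡ m * fall (m ∸ 1) ℓ
fall-suc zero    zero    = refl
fall-suc zero    (suc ℓ) = trans (cong (_* 0) (fall-suc 0 ℓ)) (*-zeroʳ 0)
fall-suc (suc m) zero    = *-comm 1 (suc m)
fall-suc (suc m) (suc ℓ) = trans (cong (_* (m ∸ ℓ)) (fall-suc (suc m) ℓ)) (*-assoc (suc m) (fall m ℓ) (m ∸ ℓ))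

binomialSum : ℕ → ℕ → ℕ → ℕ
binomialSum r m u = sumTo u (λ ℓ → (r C ℓ) * fall m ℓ)

binomialSum-zero : ∀ m u → binomialSum 0 m u ≡ 1
binomialSum-zero m zero    = refl
binomialSum-zero m (suc u) = trans (sumTo-shift u _) (cong (1 +_) (trans (sumTo-cong u vanish) (sumTo-zero u)))
  where
  vanish : ∀ ℓ → (0 C suc ℓ) * fall m (suc ℓ) ≡ 0 * fall m (suc ℓ)
  vanish ℓ = cong (_* fall m (suc ℓ)) (k>n⇒nCk≡0 {0} {suc ℓ} (s≤s z≤n))
  sumTo-zero : ∀ u → sumTo u (λ ℓ → 0 * fall m (suc ℓ)) ≡ 0
  sumTo-zero zero    = refl
  sumTo-zero (suc u) = cong (_+ 0) (sumTo-zero u)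

-- Pascal's rule turns the sum into the recurrence satisfied by `partials`.
binomialSum-suc : ∀ r m u → binomialSum (suc r) m (suc u) ≡ binomialSum r m (suc u) + m * binomialSum r (m ∸ 1) u
binomialSum-suc r m u = begin
    binomialSum (suc r) m (suc u)
  ≡⟨ sumTo-shift u _ ⟩
    1 + sumTo u (λ ℓ → (suc r C suc ℓ) * fall m (suc ℓ))
  ≡⟨ cong (1 +_) (sumTo-cong u pascal) ⟩
    1 + sumTo u (λ ℓ → (r C ℓ) * fall m (suc ℓ) + (r C suc ℓ) * fall m (suc ℓ))
  ≡⟨ cong (1 +_) (sumTo-+ u _ _) ⟩
    1 + (A + B)
  ≡⟨ rearrange 1 A B ⟩
    (1 + B) + A
  ≡⟨ cong₂ _+_ (sym (sumTo-shift u _)) (sumTo-cong u falling) ⟩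
    binomialSum r m (suc u) + sumTo u (λ ℓ → m * ((r C ℓ) * fall (m ∸ 1) ℓ))
  ≡⟨ cong (binomialSum r m (suc u) +_) (sumTo-* u m _) ⟩
    binomialSum r m (suc u) + m * binomialSum r (m ∸ 1) u
  ∎
  where
  open ≡-Reasoning
  A = sumTo u (λ ℓ → (r C ℓ) * fall m (suc ℓ))
  B = sumTo u (λ ℓ → (r C suc ℓ) * fall m (suc ℓ))
  pascal : ∀ ℓ → (suc r C suc ℓ) * fall m (suc ℓ) ≡ (r C ℓ) * fall m (suc ℓ) + (r C suc ℓ) * fall m (suc ℓ)
  pascal ℓ = trans (cong (_* fall m (suc ℓ)) (sym (nCk+nC[k+1]≡[n+1]C[k+1] r ℓ))) (*-distribʳ-+ _ (r C ℓ) _)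
  rearrange : ∀ x y z → x + (y + z) ≡ (x + z) + y
  rearrange = solve-∀
  falling : ∀ ℓ → (r C ℓ) * fall m (suc ℓ) ≡ m * ((r C ℓ) * fall (m ∸ 1) ℓ)
  falling ℓ = trans (cong ((r C ℓ) *_) (fall-suc m ℓ)) (x*[y*z]≡y*[x*z] (r C ℓ) m _)
    where
    x*[y*z]≡y*[x*z] : ∀ x y z → x * (y * z) ≡ y * (x * z)
    x*[y*z]≡y*[x*z] = solve-∀

binomialSum≤partials : ∀ r m u → binomialSum r m u ≤ partials r m
binomialSum≤partials zero    m u       = ≤-reflexive (binomialSum-zero m u)
binomialSum≤partials (suc r) m zero    = partials-positive (suc r) m
binomialSum≤partials (suc r) m (suc u) = begin
    binomialSum (suc r) m (suc u)
  ≡⟨ binomialSum-suc r m u ⟩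
    binomialSum r m (suc u) + m * binomialSum r (m ∸ 1) u
  ≤⟨ +-mono-≤ (binomialSum≤partials r m (suc u)) (*-monoʳ-≤ m (binomialSum≤partials r (m ∸ 1) u)) ⟩
    partials (suc r) m
  ∎
  where open ≤-Reasoning

-- Hence m colours suffice to give t chains of length r pairwise different patterns.
Ok⇒≤partials : ∀ {r t m} → Ok r t m → t ≤ partials r m
Ok⇒≤partials {r} {m = m} ok = ≤-trans ok (binomialSum≤partials r m (r ⊓ m))

-- Patterns.  A pattern with m colours assigns to each position 1, 2, … at most one
-- colour; position 0 is never used.  It is injective if no colour is used twice.
Pattern : ℕ → Set
Pattern m = ℕ → Maybe (Fin m)

InjectivePattern : ∀ {m} → Pattern m → Set
InjectivePattern π = ∀ b b' {c} → π b ≡ just c → π b' ≡ just c → b ≡ b'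

_◃_ : ∀ {m} → Maybe (Fin m) → Pattern m → Pattern m
(h ◃ π) zero          = nothing
(h ◃ π) (suc zero)    = h
(h ◃ π) (suc (suc b)) = π (suc b)

◃-nothing-injective : ∀ {m} {π : Pattern m} → InjectivePattern π → InjectivePattern (nothing ◃ π)
◃-nothing-injective π-inj (suc (suc b)) (suc (suc b')) πb πb' = cong suc (π-inj (suc b) (suc b') πb πb')

-- Recolouring the tail by `punchIn c` keeps it away from the colour c used at position 1.
◃-just-injective : ∀ {m} c {π : Pattern m} → InjectivePattern π →
                   InjectivePattern (just c ◃ (Maybe.map (punchIn c) ∘ π))
◃-just-injective c {π} π-inj = inj
  where
  avoids : ∀ b {c'} → Maybe.map (punchIn c) (π b) ≡ just c' → c' ≢ c
  avoids b e with π b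
  avoids b refl | just z = Finₚ.punchInᵢ≢i c z
  inj : InjectivePattern (just c ◃ (Maybe.map (punchIn c) ∘ π))
  inj (suc zero)    (suc zero)     e e'   = refl
  inj (suc zero)    (suc (suc b')) refl e' = ⊥-elim (avoids (suc b') e' refl)
  inj (suc (suc b)) (suc zero)     e refl = ⊥-elim (avoids (suc b) e refl)
  inj (suc (suc b)) (suc (suc b')) e e' with π (suc b) in πb | π (suc b') in πb'
  inj (suc (suc b)) (suc (suc b')) refl e' | just z | just z' =
    cong suc (π-inj (suc b) (suc b') πb (trans πb' (cong just (Finₚ.punchIn-injective c z' z (just-injective e')))))

◃-injective : ∀ {m} {h h' : Maybe (Fin m)} {π π' : Pattern m} → (∀ b → (h ◃ π) b ≡ (h' ◃ π') b) →
              h ≡ h' × (∀ b → π (suc b) ≡ π' (suc b))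
◃-injective e = e 1 , λ b → e (suc (suc b))

-- Decoding.  Every code u < partials r m names a pattern on positions 1 … r
-- following the recursion defining `partials`.
mutual
  decode : ∀ r m → Fin (partials r m) → Pattern m
  decode zero    m u _ = nothing
  decode (suc r) m u   = decodeStep r m (splitAt (partials r m) u)

  decodeStep : ∀ r m → Fin (partials r m) ⊎ Fin (m * partials r (m ∸ 1)) → Pattern m
  decodeStep r m       (inj₁ u) = nothing ◃ decode r m u
  decodeStep r (suc m) (inj₂ w) = just c ◃ (Maybe.map (punchIn c) ∘ decode r m u)
    where
    c = proj₁ (remQuot {suc m} (partials r m) w)
    u = proj₂ (remQuot {suc m} (partials r m) w)

decode-zero : ∀ r m u → decode r m u 0 ≡ nothing
decode-zero zero    m u = refl
decode-zero (suc r) m u with splitAt (partials r m) u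
... | inj₁ _ = refl
decode-zero (suc r) (suc m) u | inj₂ _ = refl

decode-beyond : ∀ r m u b → r < b → decode r m u b ≡ nothing
decode-beyond zero    m u b r<b = refl
decode-beyond (suc r) m u (suc (suc b)) (s≤s r<b) with splitAt (partials r m) u
... | inj₁ u' = decode-beyond r m u' (suc b) r<b
decode-beyond (suc r) (suc m) u (suc (suc b)) (s≤s r<b) | inj₂ w = cong (Maybe.map _) (decode-beyond r m _ (suc b) r<b)

decode-injectivePattern : ∀ r m u → InjectivePattern (decode r m u)
decode-injectivePattern zero    m u b b' ()
decode-injectivePattern (suc r) m u with splitAt (partials r m) u
... | inj₁ u' = ◃-nothing-injective (decode-injectivePattern r m u')
decode-injectivePattern (suc r) (suc m) u | inj₂ w =
  ◃-just-injective _ (decode-injectivePattern r m (proj₂ (remQuot {suc m} (partials r m) w)))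

mutual
  decode-injective : ∀ r m u u' → (∀ b → decode r m u b ≡ decode r m u' b) → u ≡ u'
  decode-injective zero    m Fin.zero Fin.zero e = refl
  decode-injective (suc r) m u u' e = begin
      u
    ≡⟨ sym (Finₚ.join-splitAt (partials r m) (m * partials r (m ∸ 1)) u) ⟩
      join (partials r m) (m * partials r (m ∸ 1)) (splitAt (partials r m) u)
    ≡⟨ cong (join (partials r m) (m * partials r (m ∸ 1))) (decodeStep-injective r m (splitAt (partials r m) u) (splitAt (partials r m) u') e) ⟩
      join (partials r m) (m * partials r (m ∸ 1)) (splitAt (partials r m) u')
    ≡⟨ Finₚ.join-splitAt (partials r m) (m * partials r (m ∸ 1)) u' ⟩
      u'
    ∎
    where open ≡-Reasoning

  decodeStep-injective : ∀ r m s s' → (∀ b → decodeStep r m s b ≡ decodeStep r m s' b) → s ≡ s'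
  decodeStep-injective r m (inj₁ u) (inj₁ u') e =
    cong inj₁ (decode-injective r m u u' (tails-agree (proj₂ (◃-injective e))))
    where
    tails-agree : (∀ b → decode r m u (suc b) ≡ decode r m u' (suc b)) → ∀ b → decode r m u b ≡ decode r m u' b
    tails-agree e zero    = trans (decode-zero r m u) (sym (decode-zero r m u'))
    tails-agree e (suc b) = e b
  decodeStep-injective r (suc m) (inj₁ _) (inj₂ _) e with e 1
  ... | ()
  decodeStep-injective r (suc m) (inj₂ _) (inj₁ _) e with e 1
  ... | ()
  decodeStep-injective r (suc m) (inj₂ w) (inj₂ w') e = cong inj₂ (begin
      w
    ≡⟨ sym (Finₚ.combine-remQuot {suc m} (partials r m) w) ⟩
      combine c u
    ≡⟨ cong₂ combine c≡c' (decode-injective r m u u' tails-agree) ⟩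
      combine c' u'
    ≡⟨ Finₚ.combine-remQuot {suc m} (partials r m) w' ⟩
      w'
    ∎)
    where
    open ≡-Reasoning
    c  = proj₁ (remQuot {suc m} (partials r m) w)
    u  = proj₂ (remQuot {suc m} (partials r m) w)
    c' = proj₁ (remQuot {suc m} (partials r m) w')
    u' = proj₂ (remQuot {suc m} (partials r m) w')
    c≡c' : c ≡ c'
    c≡c' = just-injective (proj₁ (◃-injective e))
    tails-agree : ∀ b → decode r m u b ≡ decode r m u' b
    tails-agree zero    = trans (decode-zero r m u) (sym (decode-zero r m u'))
    tails-agree (suc b) = map-injective {f = punchIn c'} (Finₚ.punchIn-injective c' _ _)
      (trans (cong (λ z → Maybe.map (punchIn z) (decode r m u (suc b))) (sym c≡c')) (proj₂ (◃-injective e) b))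

decode-injective-ℕ : ∀ r r' m m' (u : Fin (partials r m)) (u' : Fin (partials r' m')) → r ≡ r' → m ≡ m' →
                     (∀ b → Maybe.map toℕ (decode r m u b) ≡ Maybe.map toℕ (decode r' m' u' b)) → toℕ u ≡ toℕ u'
decode-injective-ℕ r .r m .m u u' refl refl e =
  cong toℕ (decode-injective r m u u' (λ b → map-injective Finₚ.toℕ-injective (e b)))

index-injective : ∀ {A : Set} {xs ys : List A} {x y} → xs ≡ ys → (x∈ : x ∈ xs) (y∈ : y ∈ ys) →
                  toℕ (index x∈) ≡ toℕ (index y∈) → x ≡ y
index-injective {xs = xs} refl x∈ y∈ e =
  trans (lookup-index x∈) (trans (cong (lookup xs) (Finₚ.toℕ-injective e)) (sym (lookup-index y∈)))

prime≢1 : ∀ {P} → Prime P → P ≢ 1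
prime≢1 P-prime refl = ¬prime[1] P-prime

prime>1 : ∀ {P} → Prime P → 1 < P
prime>1 {0}           P-prime = ⊥-elim (¬prime[0] P-prime)
prime>1 {1}           P-prime = ⊥-elim (¬prime[1] P-prime)
prime>1 {suc (suc _)} P-prime = s≤s (s≤s z≤n)

prime∣prime⇒≡ : ∀ {P Q} → Prime P → Prime Q → P ∣ Q → P ≡ Q
prime∣prime⇒≡ P-prime Q-prime P∣Q with prime⇒irreducible Q-prime P∣Q
... | inj₁ P≡1 = ⊥-elim (prime≢1 P-prime P≡1)
... | inj₂ P≡Q = P≡Q

prime∣^⇒∣ : ∀ {P} q e → Prime P → P ∣ q ^ e → P ∣ q
prime∣^⇒∣ q zero    P-prime P∣1 = ⊥-elim (prime≢1 P-prime (∣1⇒≡1 P∣1))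
prime∣^⇒∣ q (suc e) P-prime P∣q^e+1 with euclidsLemma q (q ^ e) P-prime P∣q^e+1
... | inj₁ P∣q   = P∣q
... | inj₂ P∣q^e = prime∣^⇒∣ q e P-prime P∣q^e

^-monoʳ-∣ : ∀ m {b c} → b ≤ c → m ^ b ∣ m ^ c
^-monoʳ-∣ m {b} {c} b≤c = divides (m ^ (c ∸ b)) (begin
    m ^ c                 ≡⟨ cong (m ^_) (sym (m+[n∸m]≡n b≤c)) ⟩
    m ^ (b + (c ∸ b))     ≡⟨ ^-distribˡ-+-* m b (c ∸ b) ⟩
    m ^ b * m ^ (c ∸ b)   ≡⟨ *-comm (m ^ b) _ ⟩
    m ^ (c ∸ b) * m ^ b   ∎)
  where open ≡-Reasoning

^-cancelʳ-∣ : ∀ m {b c} → 1 < m → m ^ b ∣ m ^ c → b ≤ c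
^-cancelʳ-∣ m@(suc _) {b} {c} 1<m m^b∣m^c with b ≤? c
... | yes b≤c = b≤c
... | no  b≰c = ⊥-elim (<⇒≱ (^-monoʳ-< m 1<m (≰⇒> b≰c)) (∣⇒≤ {{m^n≢0 m c}} m^b∣m^c))

prime^∣*⇒∣ : ∀ {P} b x y → Prime P → ¬ P ∣ x → P ^ b ∣ x * y → P ^ b ∣ y
prime^∣*⇒∣ zero    x y P-prime P∤x _ = 1∣ y
prime^∣*⇒∣ {P} (suc b) x y P-prime P∤x P^b+1∣xy with euclidsLemma x y P-prime (∣-trans (m∣m*n (P ^ b)) P^b+1∣xy)
... | inj₁ P∣x = ⊥-elim (P∤x P∣x)
... | inj₂ (divides y' refl) = subst (P * P ^ b ∣_) (*-comm P y') (*-monoʳ-∣ P P^b∣y')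
  where
  instance _ = prime⇒nonZero P-prime
  P^b∣y' : P ^ b ∣ y'
  P^b∣y' = prime^∣*⇒∣ b x y' P-prime P∤x
    (*-cancelˡ-∣ P (subst (P * P ^ b ∣_) (x*[y*z]≡z*[x*y] x y' P) P^b+1∣xy))
    where
    x*[y*z]≡z*[x*y] : ∀ x y z → x * (y * z) ≡ z * (x * y)
    x*[y*z]≡z*[x*y] = solve-∀

primeFactor : ∀ x → x ≢ 0 → x ≢ 1 → ∃ λ P → Prime P × P ∣ x
primeFactor zero    x≢0 _ = ⊥-elim (x≢0 refl)
primeFactor (suc x) _ x≢1 with factorise (suc x)
... | record { factors = [] ; isFactorisation = e } = ⊥-elim (x≢1 e)
... | record { factors = P ∷ Ps ; isFactorisation = e ; factorsPrime = P-prime ∷ _ } =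
  P , P-prime , divides (product Ps) (trans e (*-comm P _))

prime-power-criterion : ∀ x y → x ≢ 0 → (∀ {P} c → Prime P → P ^ c ∣ x → P ^ c ∣ y) → x ∣ y
prime-power-criterion x y = go x y (<-wellFounded x)
  where
  go : ∀ x y → Acc _<_ x → x ≢ 0 → (∀ {P} c → Prime P → P ^ c ∣ x → P ^ c ∣ y) → x ∣ y
  go x y (acc rec) x≢0 powers with x ≟ 1
  ... | yes refl = 1∣ y
  ... | no x≢1 with primeFactor x x≢0 x≢1
  ... | P , P-prime , P∣x with P∣x | powers 1 P-prime (subst (_∣ x) (sym (*-identityʳ P)) P∣x)
  ... | divides x' refl | P∣y with subst (_∣ y) (*-identityʳ P) P∣y
  ... | divides y' refl = *-monoˡ-∣ P (go x' y' (rec x'<x) x'≢0 powers')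
    where
    instance _ = prime⇒nonZero P-prime
    x'≢0 : x' ≢ 0
    x'≢0 refl = x≢0 refl
    x'<x : x' < x' * P
    x'<x = m<m*n x' P {{≢-nonZero x'≢0}} (prime>1 P-prime)
    powers' : ∀ {Q} c → Prime Q → Q ^ c ∣ x' → Q ^ c ∣ y'
    powers' {Q} c Q-prime Q^c∣x' with Q ≟ P
    ... | yes refl = *-cancelʳ-∣ Q (subst₂ _∣_ (*-comm Q (Q ^ c)) refl
                       (powers (suc c) Q-prime (subst (_∣ x' * Q) (*-comm (Q ^ c) Q) (*-monoˡ-∣ Q Q^c∣x'))))
    ... | no Q≢P = prime^∣*⇒∣ c P y' Q-prime (Q≢P ∘ prime∣prime⇒≡ Q-prime P-prime)
                     (subst (Q ^ c ∣_) (*-comm y' P) (powers c Q-prime (∣-trans Q^c∣x' (m∣m*n P))))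

valuation : ℕ → ℕ → ℕ → ℕ
valuation P zero    x = 0
valuation P (suc B) x with P ^ suc B ∣? x
... | yes _ = suc B
... | no  _ = valuation P B x

valuation-∣ : ∀ P B x → P ^ valuation P B x ∣ x
valuation-∣ P zero    x = 1∣ x
valuation-∣ P (suc B) x with P ^ suc B ∣? x
... | yes P^B+1∣x = P^B+1∣x
... | no  _       = valuation-∣ P B x

valuation-≤ : ∀ P B x → valuation P B x ≤ B
valuation-≤ P zero    x = z≤n
valuation-≤ P (suc B) x with P ^ suc B ∣? x
... | yes _ = ≤-refl
... | no  _ = m≤n⇒m≤1+n (valuation-≤ P B x)

valuation-maximal : ∀ P B x c → c ≤ B → P ^ c ∣ x → c ≤ valuation P B x
valuation-maximal P zero    x .0 z≤n _ = z≤n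
valuation-maximal P (suc B) x c c≤B+1 P^c∣x with P ^ suc B ∣? x
... | yes _ = c≤B+1
... | no P^B+1∤x with m≤n⇒m<n∨m≡n c≤B+1
...   | inj₁ c<B+1 = valuation-maximal P B x c (≤-pred c<B+1) P^c∣x
...   | inj₂ refl  = ⊥-elim (P^B+1∤x P^c∣x)

≤-≤suc⇒≡⊎≡suc : ∀ {b c} → b ≤ c → c ≤ suc b → c ≡ b ⊎ c ≡ suc b
≤-≤suc⇒≡⊎≡suc b≤c c≤b+1 with m≤n⇒m<n∨m≡n c≤b+1
... | inj₁ c<b+1 = inj₁ (≤-antisym (≤-pred c<b+1) b≤c)
... | inj₂ c≡b+1 = inj₂ c≡b+1

prime-powers : ∀ {k} → (Fin k → ℕ) → (Fin k → ℕ) → ℕ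
prime-powers p a = prodF (λ i → p i ^ a i)

prime-powers-suc : ∀ {k} (p a : Fin (suc k) → ℕ) →
                   prime-powers p a ≡ p Fin.zero ^ a Fin.zero * prime-powers (p ∘ Fin.suc) (a ∘ Fin.suc)
prime-powers-suc p a = prodF-suc (λ i → p i ^ a i)

prime∣prime-powers : ∀ {k} (p a : Fin k → ℕ) → (∀ i → Prime (p i)) →
                     ∀ {P} → Prime P → P ∣ prime-powers p a → ∃ λ i → P ≡ p i
prime∣prime-powers {zero} p a p-prime P-prime P∣1 = ⊥-elim (prime≢1 P-prime (∣1⇒≡1 P∣1))
prime∣prime-powers {suc k} p a p-prime {P} P-prime P∣n
  with euclidsLemma (p Fin.zero ^ a Fin.zero) _ P-prime (subst (P ∣_) (prime-powers-suc p a) P∣n)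
... | inj₁ P∣p₀^a₀ = Fin.zero , prime∣prime⇒≡ P-prime (p-prime Fin.zero) (prime∣^⇒∣ _ (a Fin.zero) P-prime P∣p₀^a₀)
... | inj₂ P∣rest with prime∣prime-powers (p ∘ Fin.suc) (a ∘ Fin.suc) (p-prime ∘ Fin.suc) P-prime P∣rest
...   | i , P≡pᵢ = Fin.suc i , P≡pᵢ

distinct-prime-powers : ∀ {P Q} c b → Prime P → Prime Q → P ≢ Q → P ^ c ∣ Q ^ b → c ≡ 0
distinct-prime-powers zero    b P-prime Q-prime P≢Q _ = refl
distinct-prime-powers (suc c) b P-prime Q-prime P≢Q P^c+1∣Q^b =
  ⊥-elim (P≢Q (prime∣prime⇒≡ P-prime Q-prime (prime∣^⇒∣ _ b P-prime (∣-trans (m∣m*n _) P^c+1∣Q^b))))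

^∣prime-powers : ∀ {k} (p a : Fin k → ℕ) i b → b ≤ a i → p i ^ b ∣ prime-powers p a
^∣prime-powers {suc k} p a Fin.zero b b≤a₀ = subst (p Fin.zero ^ b ∣_) (sym (prime-powers-suc p a))
  (∣-trans (^-monoʳ-∣ (p Fin.zero) b≤a₀) (m∣m*n _))
^∣prime-powers {suc k} p a (Fin.suc i) b b≤aᵢ = subst (p (Fin.suc i) ^ b ∣_) (sym (prime-powers-suc p a))
  (∣-trans (^∣prime-powers (p ∘ Fin.suc) (a ∘ Fin.suc) i b b≤aᵢ) (n∣m*n (p Fin.zero ^ a Fin.zero)))

^∣prime-powers⇒≤ : ∀ {k} (p a : Fin k → ℕ) → Injective _≡_ _≡_ p → (∀ i → Prime (p i)) →
                    ∀ i b → p i ^ b ∣ prime-powers p a → b ≤ a i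
^∣prime-powers⇒≤ {suc k} p a p-inj p-prime Fin.zero b p₀^b∣n with b ≤? a Fin.zero
... | yes b≤a₀ = b≤a₀
... | no  b≰a₀ = ⊥-elim (p₀∤rest (*-cancelˡ-∣ (p₀ ^ a₀) p₀^a₀*p₀∣p₀^a₀*rest))
  where
  p₀ = p Fin.zero
  a₀ = a Fin.zero
  instance _ = m^n≢0 p₀ a₀ {{prime⇒nonZero (p-prime Fin.zero)}}
  p₀∤rest : ¬ p₀ ∣ prime-powers (p ∘ Fin.suc) (a ∘ Fin.suc)
  p₀∤rest p₀∣rest with prime∣prime-powers (p ∘ Fin.suc) (a ∘ Fin.suc) (p-prime ∘ Fin.suc) (p-prime Fin.zero) p₀∣rest
  ... | j , p₀≡pⱼ₊₁ with p-inj p₀≡pⱼ₊₁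
  ...   | ()
  p₀^a₀*p₀∣p₀^a₀*rest : p₀ ^ a₀ * p₀ ∣ p₀ ^ a₀ * prime-powers (p ∘ Fin.suc) (a ∘ Fin.suc)
  p₀^a₀*p₀∣p₀^a₀*rest = subst₂ _∣_ (*-comm p₀ (p₀ ^ a₀)) (prime-powers-suc p a)
    (∣-trans (^-monoʳ-∣ p₀ (≰⇒> b≰a₀)) p₀^b∣n)
^∣prime-powers⇒≤ {suc k} p a p-inj p-prime (Fin.suc i) b pᵢ^b∣n =
  ^∣prime-powers⇒≤ (p ∘ Fin.suc) (a ∘ Fin.suc) (Finₚ.suc-injective ∘ p-inj) (p-prime ∘ Fin.suc) i b
    (prime^∣*⇒∣ b _ _ (p-prime (Fin.suc i)) pᵢ∤p₀^a₀ (subst (p (Fin.suc i) ^ b ∣_) (prime-powers-suc p a) pᵢ^b∣n))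
  where
  pᵢ∤p₀^a₀ : ¬ p (Fin.suc i) ∣ p Fin.zero ^ a Fin.zero
  pᵢ∤p₀^a₀ pᵢ∣p₀^a₀ with p-inj (prime∣prime⇒≡ (p-prime (Fin.suc i)) (p-prime Fin.zero) (prime∣^⇒∣ _ (a Fin.zero) (p-prime (Fin.suc i)) pᵢ∣p₀^a₀))
  ... | ()

prime-powers≢0 : ∀ {k} (p a : Fin k → ℕ) → (∀ i → Prime (p i)) → prime-powers p a ≢ 0
prime-powers≢0 {zero}  p a p-prime ()
prime-powers≢0 {suc k} p a p-prime n≡0 with m*n≡0⇒m≡0∨n≡0 (p Fin.zero ^ a Fin.zero) (trans (sym (prime-powers-suc p a)) n≡0)
... | inj₁ p₀^a₀≡0 = ≢-nonZero⁻¹ _ {{m^n≢0 (p Fin.zero) (a Fin.zero) {{prime⇒nonZero (p-prime Fin.zero)}}}} p₀^a₀≡0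
... | inj₂ rest≡0  = prime-powers≢0 (p ∘ Fin.suc) (a ∘ Fin.suc) (p-prime ∘ Fin.suc) rest≡0

module Divisors {k} (p a : Fin k → ℕ) (p-injective : Injective _≡_ _≡_ p) (p-prime : ∀ i → Prime (p i)) where

  n : ℕ
  n = prime-powers p a

  -- Valuations at the primes p_i.  Capping at a_i loses nothing for divisors of n.
  v : Fin k → ℕ → ℕ
  v i = valuation (p i) (a i)

  v-≤ : ∀ i x → v i x ≤ a i
  v-≤ i = valuation-≤ (p i) (a i)

  ≤v⇒∣ : ∀ i x c → c ≤ v i x → p i ^ c ∣ x
  ≤v⇒∣ i x c c≤v = ∣-trans (^-monoʳ-∣ (p i) c≤v) (valuation-∣ (p i) (a i) x)

  v-maximal : ∀ i x c → x ∣ n → p i ^ c ∣ x → c ≤ v i x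
  v-maximal i x c x∣n pᵢ^c∣x =
    valuation-maximal (p i) (a i) x c (^∣prime-powers⇒≤ p a p-injective p-prime i c (∣-trans pᵢ^c∣x x∣n)) pᵢ^c∣x

  v-mono : ∀ i x y → x ∣ y → v i x ≤ v i y
  v-mono i x y x∣y = valuation-maximal (p i) (a i) y (v i x) (v-≤ i x) (∣-trans (valuation-∣ (p i) (a i) x) x∣y)

  v-power : ∀ i b → b ≤ a i → v i (p i ^ b) ≡ b
  v-power i b b≤aᵢ = ≤-antisym (^-cancelʳ-∣ (p i) (prime>1 (p-prime i)) (valuation-∣ (p i) (a i) (p i ^ b)))
                               (valuation-maximal (p i) (a i) (p i ^ b) b b≤aᵢ ∣-refl)

  distinct-p-powers : ∀ i j c b → j ≢ i → p j ^ c ∣ p i ^ b → c ≡ 0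
  distinct-p-powers i j c b j≢i = distinct-prime-powers c b (p-prime j) (p-prime i) (j≢i ∘ p-injective)

  v-other-power : ∀ i j b → j ≢ i → v j (p i ^ b) ≡ 0
  v-other-power i j b j≢i = distinct-p-powers i j _ b j≢i (valuation-∣ (p j) (a j) (p i ^ b))

  n≢0 : n ≢ 0
  n≢0 = prime-powers≢0 p a p-prime

  ∣-by-valuations : ∀ x y → x ∣ n → (∀ i → v i x ≤ v i y) → x ∣ y
  ∣-by-valuations x y x∣n v≤v = prime-power-criterion x y x≢0 powers
    where
    x≢0 : x ≢ 0
    x≢0 refl = n≢0 (0∣⇒≡0 x∣n)
    powers : ∀ {P} c → Prime P → P ^ c ∣ x → P ^ c ∣ y
    powers zero    P-prime _ = 1∣ y
    powers (suc c) P-prime P^c+1∣x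
      with prime∣prime-powers p a p-prime P-prime (∣-trans (∣-trans (m∣m*n _) P^c+1∣x) x∣n)
    ... | i , refl = ≤v⇒∣ i y (suc c) (≤-trans (v-maximal i x (suc c) x∣n P^c+1∣x) (v≤v i))

  ∣power⇒power : ∀ i b u → b ≤ a i → u ∣ p i ^ b → u ≡ p i ^ v i u
  ∣power⇒power i b u b≤aᵢ u∣pᵢ^b = ∣-antisym (∣-by-valuations u (p i ^ v i u) u∣n v≤v) (valuation-∣ (p i) (a i) u)
    where
    u∣n : u ∣ n
    u∣n = ∣-trans u∣pᵢ^b (^∣prime-powers p a i b b≤aᵢ)
    v≤v : ∀ j → v j u ≤ v j (p i ^ v i u)
    v≤v j with j Finₚ.≟ i
    ... | yes refl = ≤-reflexive (sym (v-power j (v j u) (v-≤ j u)))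
    ... | no  j≢i  = ≤-reflexive (trans (distinct-p-powers i j (v j u) b j≢i (∣-trans (valuation-∣ (p j) (a j) u) u∣pᵢ^b))
                                        (sym (v-other-power i j (v i u) j≢i)))

  L : Set
  L = Divisor n

  ⟦_⟧ : L → ℕ
  ⟦_⟧ = val {n}

  val∣n : (x : L) → ⟦ x ⟧ ∣ n
  val∣n (_ , d∣n) = toWitness d∣n

  val≢0 : (x : L) → ⟦ x ⟧ ≢ 0
  val≢0 x val≡0 = n≢0 (0∣⇒≡0 (subst (_∣ n) val≡0 (val∣n x)))

  val-injective : ∀ (x y : L) → ⟦ x ⟧ ≡ ⟦ y ⟧ → x ≡ y
  val-injective (d , t) (.d , t') refl = cong (d ,_) (T-irrelevant t t')

  bottom : L
  bottom = 1 , fromWitness (1∣ n)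

  point : ∀ i b → b ≤ a i → L
  point i b b≤aᵢ = p i ^ b , fromWitness (^∣prime-powers p a i b b≤aᵢ)

  -- The rank of x is the length  Σ_i v_i(x)  of a maximal chain below it.
  rank : L → ℕ
  rank x = sumF (λ i → v i ⟦ x ⟧)

  rank-≤ : ∀ x → rank x ≤ sumF a
  rank-≤ x = sumF-mono _ _ (λ i → v-≤ i ⟦ x ⟧)

  rank-strict : ∀ x y → ⟦ x ⟧ ∣ ⟦ y ⟧ → ⟦ x ⟧ ≢ ⟦ y ⟧ → rank x < rank y
  rank-strict x y x∣y x≢y with Finₚ.any? (λ i → v i ⟦ x ⟧ <? v i ⟦ y ⟧)
  ... | yes (i , vᵢx<vᵢy) = sumF-strict _ _ (λ j → v-mono j _ _ x∣y) i vᵢx<vᵢy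
  ... | no  none         = ⊥-elim (x≢y (∣-antisym x∣y (∣-by-valuations ⟦ y ⟧ ⟦ x ⟧ (val∣n y) v≤v)))
    where
    v≤v : ∀ i → v i ⟦ y ⟧ ≤ v i ⟦ x ⟧
    v≤v i = ≮⇒≥ (λ vᵢx<vᵢy → none (i , vᵢx<vᵢy))

  _·_ : Automorphism n → L → L
  σ · x = Inverse.to (Automorphism.perm σ) x

  ·-preserves : ∀ σ x y → ⟦ x ⟧ ∣ ⟦ y ⟧ → ⟦ σ · x ⟧ ∣ ⟦ σ · y ⟧
  ·-preserves σ x y = Equivalence.to (Automorphism.preserve σ x y)

  ·-reflects : ∀ σ x y → ⟦ σ · x ⟧ ∣ ⟦ σ · y ⟧ → ⟦ x ⟧ ∣ ⟦ y ⟧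
  ·-reflects σ x y = Equivalence.from (Automorphism.preserve σ x y)

  inverse : Automorphism n → Automorphism n
  inverse σ = record { perm = ↔-sym perm ; preserve = λ x y → mk⇔ (to⁻¹ x y) (from⁻¹ x y) }
    where
    open Automorphism σ
    back : ∀ x → Inverse.to perm (Inverse.from perm x) ≡ x
    back = Inverse.strictlyInverseˡ perm
    to⁻¹ : ∀ x y → ⟦ x ⟧ ∣ ⟦ y ⟧ → ⟦ Inverse.from perm x ⟧ ∣ ⟦ Inverse.from perm y ⟧
    to⁻¹ x y x∣y = ·-reflects σ _ _ (subst₂ (λ s t → ⟦ s ⟧ ∣ ⟦ t ⟧) (sym (back x)) (sym (back y)) x∣y)
    from⁻¹ : ∀ x y → ⟦ Inverse.from perm x ⟧ ∣ ⟦ Inverse.from perm y ⟧ → ⟦ x ⟧ ∣ ⟦ y ⟧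
    from⁻¹ x y d = subst₂ (λ s t → ⟦ s ⟧ ∣ ⟦ t ⟧) (back x) (back y) (·-preserves σ _ _ d)

  ·-inverseˡ : ∀ σ y → σ · (inverse σ · y) ≡ y
  ·-inverseˡ σ = Inverse.strictlyInverseˡ (Automorphism.perm σ)

  ·-inverseʳ : ∀ σ x → inverse σ · (σ · x) ≡ x
  ·-inverseʳ σ = Inverse.strictlyInverseʳ (Automorphism.perm σ)

  ∣·⇒ : ∀ σ z y → ⟦ z ⟧ ∣ ⟦ σ · y ⟧ → ⟦ inverse σ · z ⟧ ∣ ⟦ y ⟧
  ∣·⇒ σ z y z∣σy = ·-reflects σ _ y (subst (λ w → ⟦ w ⟧ ∣ ⟦ σ · y ⟧) (sym (·-inverseˡ σ z)) z∣σy)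

  ·∣⇒ : ∀ σ y z → ⟦ σ · y ⟧ ∣ ⟦ z ⟧ → ⟦ y ⟧ ∣ ⟦ inverse σ · z ⟧
  ·∣⇒ σ y z σy∣z = ·-reflects σ y _ (subst (λ w → ⟦ σ · y ⟧ ∣ ⟦ w ⟧) (sym (·-inverseˡ σ z)) σy∣z)

  _⋖_ : L → L → Set
  x ⋖ y = ⟦ x ⟧ ∣ ⟦ y ⟧ × ⟦ x ⟧ ≢ ⟦ y ⟧ × (∀ z → ⟦ x ⟧ ∣ ⟦ z ⟧ → ⟦ z ⟧ ∣ ⟦ y ⟧ → ⟦ z ⟧ ≡ ⟦ x ⟧ ⊎ ⟦ z ⟧ ≡ ⟦ y ⟧)

  DownChain : L → Set
  DownChain y = ∀ u w → ⟦ u ⟧ ∣ ⟦ y ⟧ → ⟦ w ⟧ ∣ ⟦ y ⟧ → ⟦ u ⟧ ∣ ⟦ w ⟧ ⊎ ⟦ w ⟧ ∣ ⟦ u ⟧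

  ·-bottom : ∀ σ → ⟦ σ · bottom ⟧ ≡ 1
  ·-bottom σ = ∣1⇒≡1 (subst (λ s → ⟦ σ · bottom ⟧ ∣ ⟦ s ⟧) (·-inverseˡ σ bottom) (·-preserves σ bottom _ (1∣ _)))

  ·-⋖ : ∀ σ x y → x ⋖ y → (σ · x) ⋖ (σ · y)
  ·-⋖ σ x y (x∣y , x≢y , between) = ·-preserves σ x y x∣y , σx≢σy , between'
    where
    σx≢σy : ⟦ σ · x ⟧ ≢ ⟦ σ · y ⟧
    σx≢σy e = x≢y (cong ⟦_⟧ (trans (sym (·-inverseʳ σ x))
                     (trans (cong (inverse σ ·_) (val-injective _ _ e)) (·-inverseʳ σ y))))
    pushed : ∀ {w} z → ⟦ inverse σ · z ⟧ ≡ ⟦ w ⟧ → ⟦ z ⟧ ≡ ⟦ σ · w ⟧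
    pushed {w} z e = cong ⟦_⟧ (trans (sym (·-inverseˡ σ z)) (cong (σ ·_) (val-injective _ w e)))
    between' : ∀ z → ⟦ σ · x ⟧ ∣ ⟦ z ⟧ → ⟦ z ⟧ ∣ ⟦ σ · y ⟧ → ⟦ z ⟧ ≡ ⟦ σ · x ⟧ ⊎ ⟦ z ⟧ ≡ ⟦ σ · y ⟧
    between' z σx∣z z∣σy with between (inverse σ · z) (·∣⇒ σ x z σx∣z) (∣·⇒ σ z y z∣σy)
    ... | inj₁ e = inj₁ (pushed z e)
    ... | inj₂ e = inj₂ (pushed z e)

  ·-DownChain : ∀ σ y → DownChain y → DownChain (σ · y)
  ·-DownChain σ y chain u w u∣σy w∣σy with chain (inverse σ · u) (inverse σ · w) (∣·⇒ σ u y u∣σy) (∣·⇒ σ w y w∣σy)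
  ... | inj₁ d = inj₁ (subst₂ (λ s t → ⟦ s ⟧ ∣ ⟦ t ⟧) (·-inverseˡ σ u) (·-inverseˡ σ w) (·-preserves σ _ _ d))
  ... | inj₂ d = inj₂ (subst₂ (λ s t → ⟦ s ⟧ ∣ ⟦ t ⟧) (·-inverseˡ σ w) (·-inverseˡ σ u) (·-preserves σ _ _ d))

  exponent-≤ : ∀ i c x → p i ^ c ∣ ⟦ x ⟧ → c ≤ a i
  exponent-≤ i c x pᵢ^c∣x = ^∣prime-powers⇒≤ p a p-injective p-prime i c (∣-trans pᵢ^c∣x (val∣n x))

  p^1≢1 : ∀ i → p i ^ 1 ≢ 1
  p^1≢1 i e = prime≢1 (p-prime i) (trans (sym (*-identityʳ (p i))) e)

  p^b≢p^b+1 : ∀ i b → p i ^ b ≢ p i ^ suc b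
  p^b≢p^b+1 i b e = <-irrefl refl (^-cancelʳ-∣ (p i) {suc b} {b} (prime>1 (p-prime i)) (subst (p i ^ suc b ∣_) (sym e) ∣-refl))

  atoms-incomparable : ∀ i j → i ≢ j → ¬ (p i ^ 1 ∣ p j ^ 1)
  atoms-incomparable i j i≢j pᵢ∣pⱼ with distinct-p-powers j i 1 1 i≢j pᵢ∣pⱼ
  ... | ()

  bottom⋖atom : ∀ i (1≤aᵢ : 1 ≤ a i) → bottom ⋖ point i 1 1≤aᵢ
  bottom⋖atom i 1≤aᵢ = 1∣ _ , p^1≢1 i ∘ sym , between
    where
    between : ∀ z → 1 ∣ ⟦ z ⟧ → ⟦ z ⟧ ∣ p i ^ 1 → ⟦ z ⟧ ≡ 1 ⊎ ⟦ z ⟧ ≡ p i ^ 1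
    between z _ z∣pᵢ with prime⇒irreducible (p-prime i) (subst (⟦ z ⟧ ∣_) (*-identityʳ (p i)) z∣pᵢ)
    ... | inj₁ z≡1  = inj₁ z≡1
    ... | inj₂ z≡pᵢ = inj₂ (trans z≡pᵢ (sym (*-identityʳ (p i))))

  point⋖point : ∀ i b (b≤aᵢ : b ≤ a i) (b+1≤aᵢ : suc b ≤ a i) → point i b b≤aᵢ ⋖ point i (suc b) b+1≤aᵢ
  point⋖point i b b≤aᵢ b+1≤aᵢ = ^-monoʳ-∣ (p i) (n≤1+n b) , p^b≢p^b+1 i b , between
    where
    between : ∀ z → p i ^ b ∣ ⟦ z ⟧ → ⟦ z ⟧ ∣ p i ^ suc b → ⟦ z ⟧ ≡ p i ^ b ⊎ ⟦ z ⟧ ≡ p i ^ suc b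
    between z pᵢ^b∣z z∣pᵢ^b+1 = Sum.map (λ c≡b → trans z≡ (cong (p i ^_) c≡b)) (λ c≡b+1 → trans z≡ (cong (p i ^_) c≡b+1))
                                        (≤-≤suc⇒≡⊎≡suc b≤c c≤b+1)
      where
      z≡ = ∣power⇒power i (suc b) ⟦ z ⟧ b+1≤aᵢ z∣pᵢ^b+1
      b≤c = ^-cancelʳ-∣ (p i) {b} {v i ⟦ z ⟧} (prime>1 (p-prime i)) (subst (p i ^ b ∣_) z≡ pᵢ^b∣z)
      c≤b+1 = ^-cancelʳ-∣ (p i) {v i ⟦ z ⟧} {suc b} (prime>1 (p-prime i)) (subst (_∣ p i ^ suc b) z≡ z∣pᵢ^b+1)

  point-DownChain : ∀ i b (b≤aᵢ : b ≤ a i) → DownChain (point i b b≤aᵢ)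
  point-DownChain i b b≤aᵢ u w u∣pᵢ^b w∣pᵢ^b with v i ⟦ u ⟧ ≤? v i ⟦ w ⟧
  ... | yes vu≤vw = inj₁ (subst₂ _∣_ (sym u≡) (sym w≡) (^-monoʳ-∣ (p i) vu≤vw))
    where
    u≡ = ∣power⇒power i b ⟦ u ⟧ b≤aᵢ u∣pᵢ^b
    w≡ = ∣power⇒power i b ⟦ w ⟧ b≤aᵢ w∣pᵢ^b
  ... | no  vu≰vw = inj₂ (subst₂ _∣_ (sym w≡) (sym u≡) (^-monoʳ-∣ (p i) (<⇒≤ (≰⇒> vu≰vw))))
    where
    u≡ = ∣power⇒power i b ⟦ u ⟧ b≤aᵢ u∣pᵢ^b
    w≡ = ∣power⇒power i b ⟦ w ⟧ b≤aᵢ w∣pᵢ^b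

  bottom-cover : ∀ x y → ⟦ x ⟧ ≡ 1 → x ⋖ y → ∃ λ l → ⟦ y ⟧ ≡ p l ^ 1
  bottom-cover x y x≡1 (x∣y , x≢y , between) with primeFactor ⟦ y ⟧ (val≢0 y) (x≢y ∘ trans x≡1 ∘ sym)
  ... | P , P-prime , P∣y with prime∣prime-powers p a p-prime P-prime (∣-trans P∣y (val∣n y))
  ... | l , refl with between (point l 1 (exponent-≤ l 1 y pₗ^1∣y)) (subst (_∣ p l ^ 1) (sym x≡1) (1∣ _)) pₗ^1∣y
    where pₗ^1∣y = subst (_∣ ⟦ y ⟧) (sym (*-identityʳ (p l))) P∣y
  ... | inj₁ pₗ≡x = ⊥-elim (p^1≢1 l (trans pₗ≡x x≡1))
  ... | inj₂ pₗ≡y = l , sym pₗ≡y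

  chain-cover : ∀ j b x y → 1 ≤ b → ⟦ x ⟧ ≡ p j ^ b → x ⋖ y → DownChain y → suc b ≤ a j × ⟦ y ⟧ ≡ p j ^ suc b
  chain-cover j b x y 1≤b x≡ (x∣y , x≢y , between) chain with suc b ≤? v j ⟦ y ⟧
  ... | yes b+1≤vy = b+1≤aⱼ , y≡
    where
    b+1≤aⱼ = ≤-trans b+1≤vy (v-≤ j ⟦ y ⟧)
    y≡ : ⟦ y ⟧ ≡ p j ^ suc b
    y≡ with between (point j (suc b) b+1≤aⱼ) (subst (_∣ p j ^ suc b) (sym x≡) (^-monoʳ-∣ (p j) (n≤1+n b))) (≤v⇒∣ j ⟦ y ⟧ (suc b) b+1≤vy)
    ... | inj₁ pⱼ^b+1≡x = ⊥-elim (p^b≢p^b+1 j b (sym (trans pⱼ^b+1≡x x≡)))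
    ... | inj₂ pⱼ^b+1≡y = sym pⱼ^b+1≡y
  ... | no  b+1≰vy = ⊥-elim (x≢y (∣-antisym x∣y (subst (⟦ y ⟧ ∣_) (sym x≡) (∣-by-valuations _ _ (val∣n y) v≤v))))
    where
    b≤aⱼ = exponent-≤ j b x (subst (p j ^ b ∣_) (sym x≡) ∣-refl)
    -- every other prime p_l dividing y would be incomparable with p_j ∣ y
    no-other-prime : ∀ l → l ≢ j → v l ⟦ y ⟧ ≡ 0
    no-other-prime l l≢j with v l ⟦ y ⟧ in vₗy≡ | ≤v⇒∣ l ⟦ y ⟧ 1
    ... | zero  | _ = refl
    ... | suc _ | pₗ∣y with chain (point l 1 (≤-trans (s≤s z≤n) (subst (_≤ a l) vₗy≡ (v-≤ l ⟦ y ⟧)))) (point j 1 (≤-trans 1≤b b≤aⱼ))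
                                 (pₗ∣y (s≤s z≤n)) (∣-trans (^-monoʳ-∣ (p j) 1≤b) (subst (_∣ ⟦ y ⟧) x≡ x∣y))
    ...   | inj₁ pₗ∣pⱼ = ⊥-elim (atoms-incomparable l j l≢j pₗ∣pⱼ)
    ...   | inj₂ pⱼ∣pₗ = ⊥-elim (atoms-incomparable j l (l≢j ∘ sym) pⱼ∣pₗ)
    v≤v : ∀ l → v l ⟦ y ⟧ ≤ v l (p j ^ b)
    v≤v l with l Finₚ.≟ j
    ... | yes refl = subst (v l ⟦ y ⟧ ≤_) (sym (v-power l b b≤aⱼ)) (≤-pred (≰⇒> b+1≰vy))
    ... | no  l≢j  = ≤-reflexive (trans (no-other-prime l l≢j) (sym (v-other-power j l b l≢j)))

  -- Hence an automorphism maps the chain of powers of p_i onto that of some p_j …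
  chain-image : ∀ σ i → 1 ≤ a i → ∃ λ j → ∀ b (b≤aᵢ : b ≤ a i) → ⟦ σ · point i b b≤aᵢ ⟧ ≡ p j ^ b
  chain-image σ i 1≤aᵢ = j , image
    where
    atom = bottom-cover (σ · bottom) (σ · point i 1 1≤aᵢ) (·-bottom σ) (·-⋖ σ _ _ (bottom⋖atom i 1≤aᵢ))
    j = proj₁ atom
    image : ∀ b (b≤aᵢ : b ≤ a i) → ⟦ σ · point i b b≤aᵢ ⟧ ≡ p j ^ b
    image zero          b≤aᵢ = trans (cong (λ x → ⟦ σ · x ⟧) (val-injective _ bottom refl)) (·-bottom σ)
    image (suc zero)    b≤aᵢ = trans (cong (λ x → ⟦ σ · x ⟧) (val-injective _ (point i 1 1≤aᵢ) refl)) (proj₂ atom)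
    image (suc (suc b)) b≤aᵢ = proj₂ (chain-cover j (suc b) (σ · point i (suc b) b-1≤aᵢ) (σ · point i (suc (suc b)) b≤aᵢ) (s≤s z≤n) (image (suc b) b-1≤aᵢ)
                                 (·-⋖ σ _ _ (point⋖point i (suc b) b-1≤aᵢ b≤aᵢ))
                                 (·-DownChain σ _ (point-DownChain i (suc (suc b)) b≤aᵢ)))
      where b-1≤aᵢ = ≤-trans (n≤1+n (suc b)) b≤aᵢ

  -- … of the same length, as the inverse automorphism maps the latter back onto the former.
  chain-image-length : ∀ σ i j → 1 ≤ a i → (∀ b (b≤aᵢ : b ≤ a i) → ⟦ σ · point i b b≤aᵢ ⟧ ≡ p j ^ b) → a i ≡ a j
  chain-image-length σ i j 1≤aᵢ image = ≤-antisym aᵢ≤aⱼ aⱼ≤aᵢ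
    where
    aᵢ≤aⱼ = exponent-≤ j (a i) (σ · point i (a i) ≤-refl) (subst (p j ^ a i ∣_) (sym (image (a i) ≤-refl)) ∣-refl)
    back = chain-image (inverse σ) j (≤-trans 1≤aᵢ aᵢ≤aⱼ)
    j' = proj₁ back
    σ⁻¹pⱼ≡pᵢ : inverse σ · point j 1 (≤-trans 1≤aᵢ aᵢ≤aⱼ) ≡ point i 1 1≤aᵢ
    σ⁻¹pⱼ≡pᵢ = trans (cong (inverse σ ·_) (val-injective _ (σ · point i 1 1≤aᵢ) (sym (image 1 1≤aᵢ))))
                     (·-inverseʳ σ _)
    j'≡i : j' ≡ i
    j'≡i = p-injective (*-cancelʳ-≡ (p j') (p i) 1 (trans (sym (proj₂ back 1 _)) (cong ⟦_⟧ σ⁻¹pⱼ≡pᵢ)))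
    aⱼ≤aᵢ = subst (λ l → a j ≤ a l) j'≡i
              (exponent-≤ j' (a j) (inverse σ · point j (a j) ≤-refl) (subst (p j' ^ a j ∣_) (sym (proj₂ back (a j) ≤-refl)) ∣-refl))

  fixing-prime-powers⇒identity : ∀ σ → (∀ i b (b≤aᵢ : b ≤ a i) → ⟦ σ · point i b b≤aᵢ ⟧ ≡ p i ^ b) → ∀ x → σ · x ≡ x
  fixing-prime-powers⇒identity σ fixes x = val-injective (σ · x) x (∣-antisym σx∣x x∣σx)
    where
    σx∣x : ⟦ σ · x ⟧ ∣ ⟦ x ⟧
    σx∣x = ∣-by-valuations _ _ (val∣n (σ · x)) λ i → v-maximal i ⟦ x ⟧ _ (val∣n x)
      (·-reflects σ (point i (v i ⟦ σ · x ⟧) (v-≤ i _)) x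
        (subst (_∣ ⟦ σ · x ⟧) (sym (fixes i _ (v-≤ i _))) (valuation-∣ (p i) (a i) ⟦ σ · x ⟧)))
    x∣σx : ⟦ x ⟧ ∣ ⟦ σ · x ⟧
    x∣σx = ∣-by-valuations _ _ (val∣n x) λ i → v-maximal i ⟦ σ · x ⟧ _ (val∣n (σ · x))
      (subst (_∣ ⟦ σ · x ⟧) (fixes i _ (v-≤ i _))
        (·-preserves σ (point i (v i ⟦ x ⟧) (v-≤ i _)) x (valuation-∣ (p i) (a i) ⟦ x ⟧)))

-- Chains of the same length r are numbered; the number of chain i is
-- the code of a pattern with m_i colours, which is painted on the chain with the
-- colours N+1, …, N+M; every other point gets its rank (0 … N) as its colour.
module Colouring {k} (p a : Fin k → ℕ) (p-injective : Injective _≡_ _≡_ p) (p-prime : ∀ i → Prime (p i))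
                 (a-positive : ∀ i → 1 ≤ a i)
                 (ms : Fin k → ℕ) (ms-least : ∀ i → IsLeast (Ok (a i) (countEq a (a i))) (ms i)) where

  open Divisors p a p-injective p-prime

  M N K : ℕ
  M = maxF ms
  N = sumF a
  K = M + N + 1

  ofLength : ℕ → List (Fin k)
  ofLength r = filter (λ j → a j ≟ r) (allFin k)

  ∈ofLength : ∀ i → i ∈ ofLength (a i)
  ∈ofLength i = ∈-filter⁺ (λ j → a j ≟ a i) (∈-allFin i) refl

  -- By the choice of m_i, the position of chain i in `ofLength (a i)` is a code.
  code : ∀ i → Fin (partials (a i) (ms i))
  code i = Fin.fromℕ< (<-≤-trans (Finₚ.toℕ<n (index (∈ofLength i))) (Ok⇒≤partials {a i} {m = ms i} (proj₁ (ms-least i))))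

  ms-length : ∀ i j → a i ≡ a j → ms i ≡ ms j
  ms-length i j aᵢ≡aⱼ = ≤-antisym (proj₂ (ms-least i) (ms j) (subst (λ r → Ok r (countEq a r) (ms j)) (sym aᵢ≡aⱼ) (proj₁ (ms-least j))))
                                  (proj₂ (ms-least j) (ms i) (subst (λ r → Ok r (countEq a r) (ms i)) aᵢ≡aⱼ (proj₁ (ms-least i))))

  paint : Fin k → ℕ → Maybe ℕ
  paint i b = Maybe.map toℕ (decode (a i) (ms i) (code i) b)

  paint-< : ∀ i b {c} → paint i b ≡ just c → c < M
  paint-< i b e with decode (a i) (ms i) (code i) b
  paint-< i b refl | just c = <-≤-trans (Finₚ.toℕ<n c) (maxF-upper ms i)

  paint-injective : ∀ i b b' {c} → paint i b ≡ just c → paint i b' ≡ just c → b ≡ b'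
  paint-injective i b b' e e' with decode (a i) (ms i) (code i) b in πb | decode (a i) (ms i) (code i) b' in πb'
  paint-injective i b b' refl e' | just c | just c' =
    decode-injectivePattern (a i) (ms i) (code i) b b' πb (trans πb' (cong just (Finₚ.toℕ-injective (just-injective e'))))

  paint-zero : ∀ i → paint i 0 ≡ nothing
  paint-zero i = cong (Maybe.map toℕ) (decode-zero (a i) (ms i) (code i))

  paint-beyond : ∀ i b → a i < b → paint i b ≡ nothing
  paint-beyond i b aᵢ<b = cong (Maybe.map toℕ) (decode-beyond (a i) (ms i) (code i) b aᵢ<b)

  paint-distinguishes : ∀ i j → a i ≡ a j → (∀ b → paint i b ≡ paint j b) → i ≡ j
  paint-distinguishes i j aᵢ≡aⱼ same = index-injective (cong ofLength aᵢ≡aⱼ) (∈ofLength i) (∈ofLength j) (begin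
      toℕ (index (∈ofLength i))  ≡⟨ Finₚ.toℕ-fromℕ< _ ⟨
      toℕ (code i)                ≡⟨ decode-injective-ℕ _ _ _ _ (code i) (code j) aᵢ≡aⱼ (ms-length i j aᵢ≡aⱼ) same ⟩
      toℕ (code j)                ≡⟨ Finₚ.toℕ-fromℕ< _ ⟩
      toℕ (index (∈ofLength j))  ∎)
    where open ≡-Reasoning

  OnChain : Fin k → L → Set
  OnChain i x = 1 ≤ v i ⟦ x ⟧ × ⟦ x ⟧ ≡ p i ^ v i ⟦ x ⟧

  onChain? : ∀ x → Dec (∃ λ i → OnChain i x)
  onChain? x = Finₚ.any? (λ i → (1 ≤? v i ⟦ x ⟧) ×-dec (⟦ x ⟧ ≟ p i ^ v i ⟦ x ⟧))

  special : L → Maybe ℕ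
  special x with onChain? x
  ... | yes (i , _) = paint i (v i ⟦ x ⟧)
  ... | no  _       = nothing

  special-sound : ∀ x {c} → special x ≡ just c → ∃ λ i → ⟦ x ⟧ ≡ p i ^ v i ⟦ x ⟧ × paint i (v i ⟦ x ⟧) ≡ just c
  special-sound x e with onChain? x
  ... | yes (i , _ , x≡) = i , x≡ , e

  special-point : ∀ i b (b≤aᵢ : b ≤ a i) → special (point i b b≤aᵢ) ≡ paint i b
  special-point i b b≤aᵢ with onChain? (point i b b≤aᵢ)
  ... | yes (l , 1≤vₗ , _) with l Finₚ.≟ i
  ...   | yes refl = cong (paint i) (v-power i b b≤aᵢ)
  ...   | no  l≢i  = ⊥-elim (<⇒≱ 1≤vₗ (≤-reflexive (v-other-power i l b l≢i)))
  special-point i zero    b≤aᵢ | no _ = sym (paint-zero i)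
  special-point i (suc b) b≤aᵢ | no not-on-chain = ⊥-elim (not-on-chain (i , on-chain))
    where
    on-chain : OnChain i (point i (suc b) b≤aᵢ)
    on-chain = subst (1 ≤_) (sym (v-power i (suc b) b≤aᵢ)) (s≤s z≤n) , cong (p i ^_) (sym (v-power i (suc b) b≤aᵢ))

  -- Colours 0 … N are ranks, colour N + 1 + c is the special colour c < M.
  colourValue : Maybe ℕ → ℕ → ℕ
  colourValue (just c) r = suc (N + c)
  colourValue nothing  r = r

  colourValue-injective : ∀ s s' r r' → r ≤ N → r' ≤ N → colourValue s r ≡ colourValue s' r' → s ≡ s'
  colourValue-injective (just c) (just c') r r' _    _     e = cong just (+-cancelˡ-≡ N c c' (suc-injective e))
  colourValue-injective (just c) nothing   r r' _    r'≤N e = ⊥-elim (<⇒≱ (s≤s (m≤m+n N c)) (subst (_≤ N) (sym e) r'≤N))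
  colourValue-injective nothing  (just c') r r' r≤N _    e = ⊥-elim (<⇒≱ (s≤s (m≤m+n N c')) (subst (_≤ N) e r≤N))
  colourValue-injective nothing  nothing   r r' _    _     e = refl

  colourℕ : L → ℕ
  colourℕ x = colourValue (special x) (rank x)

  colourℕ-< : ∀ x → colourℕ x < K
  colourℕ-< x with special x in sx
  ... | just c  = subst (suc (N + c) <_) (+-comm 1 (M + N))
                    (s≤s (subst (N + c <_) (+-comm N M) (+-monoʳ-< N (paint-< i _ (proj₂ (proj₂ (special-sound x sx)))))))
    where i = proj₁ (special-sound x sx)
  ... | nothing = subst (rank x <_) (+-comm 1 (M + N)) (s≤s (≤-trans (rank-≤ x) (m≤n+m N M)))

  colour : L → Fin K
  colour x = Fin.fromℕ< (colourℕ-< x)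

  colour≡⇒colourℕ≡ : ∀ x y → colour x ≡ colour y → colourℕ x ≡ colourℕ y
  colour≡⇒colourℕ≡ x y e = trans (sym (Finₚ.toℕ-fromℕ< (colourℕ-< x))) (trans (cong toℕ e) (Finₚ.toℕ-fromℕ< (colourℕ-< y)))

  same-colour⇒same-special : ∀ x y → colour x ≡ colour y → special x ≡ special y
  same-colour⇒same-special x y e = colourValue-injective _ _ (rank x) (rank y) (rank-≤ x) (rank-≤ y) (colour≡⇒colourℕ≡ x y e)

  same-special⇒equal : ∀ x y {c} → ⟦ x ⟧ ∣ ⟦ y ⟧ → special x ≡ just c → special y ≡ just c → ⟦ x ⟧ ≡ ⟦ y ⟧
  same-special⇒equal x y x∣y sx sy with special-sound x sx | special-sound y sy
  ... | i , x≡ , paintᵢ | j , y≡ , paintⱼ with i Finₚ.≟ j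
  ...   | no  i≢j  = ⊥-elim (vᵢx≢0 (distinct-p-powers j i (v i ⟦ x ⟧) (v j ⟦ y ⟧) i≢j (subst₂ _∣_ x≡ y≡ x∣y)))
    where
    vᵢx≢0 : v i ⟦ x ⟧ ≢ 0
    vᵢx≢0 vᵢx≡0 with trans (sym (paint-zero i)) (trans (cong (paint i) (sym vᵢx≡0)) paintᵢ)
    ... | ()
  ...   | yes refl = trans x≡ (trans (cong (p i ^_) (paint-injective i _ _ paintᵢ paintⱼ)) (sym y≡))

  -- Comparable points either differ in rank or are distinguished by their special colours.
  proper : Proper colour
  proper x y x∣y x≢y same with special x in sx | special y in sy | same-colour⇒same-special x y same
  ... | nothing | nothing | _    = <-irrefl same-rank (rank-strict x y x∣y (x≢y ∘ val-injective x y))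
    where
    same-rank : rank x ≡ rank y
    same-rank = trans (cong (λ s → colourValue s (rank x)) (sym sx))
                      (trans (colour≡⇒colourℕ≡ x y same) (cong (λ s → colourValue s (rank y)) sy))
  ... | just c  | just .c | refl = x≢y (val-injective x y (same-special⇒equal x y x∣y sx sy))

  -- A colour-preserving automorphism maps each chain i onto itself: the image chain j
  -- has the same length and carries the same pattern, so j = i.
  image-chain-is-same : ∀ σ → (∀ x → colour (σ · x) ≡ colour x) → ∀ i j →
                        (∀ b (b≤aᵢ : b ≤ a i) → ⟦ σ · point i b b≤aᵢ ⟧ ≡ p j ^ b) → i ≡ j
  image-chain-is-same σ preserves i j image = paint-distinguishes i j aᵢ≡aⱼ same-paint
    where
    aᵢ≡aⱼ = chain-image-length σ i j (a-positive i) image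
    same-paint : ∀ b → paint i b ≡ paint j b
    same-paint b with b ≤? a i
    ... | yes b≤aᵢ = begin
        paint i b                     ≡⟨ special-point i b b≤aᵢ ⟨
        special (point i b b≤aᵢ)      ≡⟨ same-colour⇒same-special (σ · point i b b≤aᵢ) (point i b b≤aᵢ) (preserves (point i b b≤aᵢ)) ⟨
        special (σ · point i b b≤aᵢ)  ≡⟨ cong special (val-injective (σ · point i b b≤aᵢ) (point j b b≤aⱼ) (image b b≤aᵢ)) ⟩
        special (point j b b≤aⱼ)      ≡⟨ special-point j b b≤aⱼ ⟩
        paint j b                     ∎
      where
      open ≡-Reasoning
      b≤aⱼ = subst (b ≤_) aᵢ≡aⱼ b≤aᵢ
    ... | no  b≰aᵢ = trans (paint-beyond i b (≰⇒> b≰aᵢ)) (sym (paint-beyond j b (subst (_< b) aᵢ≡aⱼ (≰⇒> b≰aᵢ))))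

  fixes-chains : ∀ σ → (∀ x → colour (σ · x) ≡ colour x) → ∀ i b (b≤aᵢ : b ≤ a i) → ⟦ σ · point i b b≤aᵢ ⟧ ≡ p i ^ b
  fixes-chains σ preserves i with chain-image σ i (a-positive i)
  ... | j , image = subst (λ l → ∀ b (b≤aᵢ : b ≤ a i) → ⟦ σ · point i b b≤aᵢ ⟧ ≡ p l ^ b)
                          (sym (image-chain-is-same σ preserves i j image)) image

  distinguishing : Distinguishing colour
  distinguishing σ preserves = fixing-prime-powers⇒identity σ (fixes-chains σ preserves)

theorem4p8 : (k : ℕ) (p a : Fin k → ℕ) →
    Injective _≡_ _≡_ p → (∀ i → Prime (p i)) → (∀ i → 1 ≤ a i) →
    (n : ℕ) → n ≡ prodF (λ i → p i ^ a i) →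
    (ms : Fin k → ℕ) → (∀ i → IsLeast (Ok (a i) (countEq a (a i))) (ms i)) →
    χD≤ n (maxF ms + sumF a + 1)
theorem4p8 k p a p-injective p-prime a-positive .(prodF (λ i → p i ^ a i)) refl ms ms-least =
  colour , proper , distinguishing
  where open Colouring p a p-injective p-prime a-positive ms ms-least
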